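{- Let $q$ be a prime power, $m,n,k$ positive integers and $\rho\in\{1,\ldots,\min\{k,m\}\}$. Let $\mathcal{U}$ be a rank-$\rho$-saturating $[n,k]_{q^m/q}$ system. Then \[\begin{bmatrix} n\\ \rho\end{bmatrix}_q\ge q^{m(k-\rho)}.\] In particular, $n\ge \lceil mk/\rho\rceil-m+\rho$ if $q>2$; $n\ge \lceil (mk-1)/\rho\rceil-m+\rho$ if $q=2$ and $\rho>1$; and $n\ge m(k-1)+1$ if $q=2$ and $\rho=1$.
   Context: $\begin{bmatrix} a\\ b\end{bmatrix}_q=\prod_{j=0}^{b-1}\frac{q^a-q^j}{q^b-q^j}$ is the Gaussian binomial coefficient. An $[n,k]_{q^m/q}$ system is an $n$-dimensional $\mathbb{F}_q$-subspace $\mathcal{U}\le\mathbb{F}_{q^m}^k$ with $\langle\mathcal{U}\rangle_{\mathbb{F}_{q^m}}=\mathbb{F}_{q^m}^k$; its linear set is $L_\mathcal{U}=\{\langle u\rangle_{\mathbb{F}_{q^m}}:u\in\mathcal{U}\setminus\{0\}\}\subseteq\mathrm{PG}(k-1,q^m)$. A point set $\mathcal{S}$ of $\mathrm{PG}(k-1,q^m)$ is $r$-saturating if every point lies in the projective subspace spanned by some $r+1$ points of $\mathcal{S}$ and $r$ is minimal with this property; $\mathcal{U}$ is rank-$\rho$-saturating if $L_\mathcal{U}$ is $(\rho-1)$-saturating. -}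

module Defs where

open import Level using (0ℓ)
open import Data.Nat using (ℕ; zero; suc; _∸_; _^_; _≤_; _<_)
import Data.Nat as ℕ
open import Data.Nat.DivMod using (_/_)
open import Data.Nat.Primality using (Prime)
open import Data.Fin using (Fin)
import Data.Fin as Fin
open import Data.Vec using (Vec; replicate; zipWith; map)
open import Data.Product using (Σ; ∃; ∃-syntax; _×_)
open import Relation.Binary.PropositionalEquality using (_≡_; _≢_)
open import Algebra.Structures using (IsCommutativeRing)
open import Data.Empty using (⊥)
open import Function.Definitions using (Injective)

IsPrimePower : ℕ → Set
IsPrimePower q = ∃[ p ] ∃[ e ] (Prime p × 1 ≤ e × q ≡ p ^ e)

prod : (b : ℕ) → (ℕ → ℕ) → ℕ
prod zero    f = 1
prod (suc b) f = prod b f ℕ.* f b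

-- division, with the (never used) convention x / 0 = 0
div : ℕ → ℕ → ℕ
div a zero    = 0
div a (suc b) = a / suc b

-- Gaussian binomial  [a b]_q = ∏_{j<b} (q^a - q^j)/(q^b - q^j)
-- (numerator product divided by denominator product; exact for q ≥ 2)
gauss : (q a b : ℕ) → ℕ
gauss q a b = div (prod b (λ j → q ^ a ∸ q ^ j)) (prod b (λ j → q ^ b ∸ q ^ j))

ceilDiv : ℕ → ℕ → ℕ
ceilDiv a b = div (a ℕ.+ b ∸ 1) b

record Field : Set₁ where
  infixl 7 _*_
  infixl 6 _+_
  field
    Carrier : Set
    _+_ _*_ : Carrier → Carrier → Carrier
    -_      : Carrier → Carrier
    0# 1#   : Carrier
    _⁻¹     : Carrier → Carrier
    isCommutativeRing : IsCommutativeRing _≡_ _+_ _*_ -_ 0# 1#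
    0≢1     : 0# ≢ 1#
    inverse : ∀ x → x ≢ 0# → x * (x ⁻¹) ≡ 1#

module _ (F : Field) where
  open Field F

  -- A subfield of F with exactly q elements, given as an injective
  -- map ι : Fin q → F whose image is closed under the field operations.
  record Subfield (q : ℕ) : Set where
    field
      ι      : Fin q → Carrier
      ι-inj  : Injective _≡_ _≡_ ι
      has-0  : ∃[ a ] ι a ≡ 0#
      has-1  : ∃[ a ] ι a ≡ 1#
      has-+  : ∀ a b → ∃[ c ] ι c ≡ ι a + ι b
      has-*  : ∀ a b → ∃[ c ] ι c ≡ ι a * ι b
      has-neg : ∀ a → ∃[ c ] ι c ≡ - ι a
      has-inv : ∀ a → ι a ≢ 0# → ∃[ c ] ι c ≡ ι a ⁻¹

  V : ℕ → Set
  V k = Vec Carrier k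

  0v : ∀ {k} → V k
  0v = replicate _ 0#

  _⊕_ : ∀ {k} → V k → V k → V k
  _⊕_ = zipWith _+_

  _·_ : ∀ {k} → Carrier → V k → V k
  c · v = map (c *_) v

  lincomb : ∀ {k t} → (Fin t → Carrier) → (Fin t → V k) → V k
  lincomb {t = zero}  c w = 0v
  lincomb {t = suc t} c w = (c Fin.zero · w Fin.zero) ⊕ lincomb (λ j → c (Fin.suc j)) (λ j → w (Fin.suc j))

  InSpan : ∀ {k t} → V k → (Fin t → V k) → Set
  InSpan {t = t} v w = Σ (Fin t → Carrier) λ c → v ≡ lincomb c w

  module _ {q : ℕ} (K : Subfield q) where
    open Subfield K

    -- An [n,k]_{q^m/q} system: an n-dimensional F_q-subspace U of F^k
    -- (with an F_q-basis) whose F-span is all of F^k.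
    record System (n k : ℕ) : Set₁ where
      field
        U       : V k → Set
        U-0     : U 0v
        U-+     : ∀ u w → U u → U w → U (u ⊕ w)
        U-scal  : ∀ a u → U u → U (ι a · u)
        basis   : Fin n → V k
        basis-U : ∀ i → U (basis i)
        basis-indep : ∀ (a : Fin n → Fin q) →
                      lincomb (λ i → ι (a i)) basis ≡ 0v → ∀ i → ι (a i) ≡ 0#
        basis-span  : ∀ u → U u → Σ (Fin n → Fin q) λ a → u ≡ lincomb (λ i → ι (a i)) basis
        spans-Fk    : ∀ (v : V k) → Σ ℕ λ t → Σ (Fin t → V k) λ w → ((∀ (j : Fin t) → U (w j)) × InSpan v w)

    -- Every point ⟨v⟩ of PG(k-1,q^m) lies in the projective subspace spanned
    -- by some s points ⟨u_0⟩,…,⟨u_{s-1}⟩ of the linear set L_U.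
    CoveredBy : ∀ {n k} → System n k → ℕ → Set
    CoveredBy {k = k} S s =
      ∀ (v : V k) → v ≢ 0v →
        Σ (Fin s → V k) λ u → ((∀ (i : Fin s) → System.U S (u i) × u i ≢ 0v) × InSpan v u)

    -- U is rank-ρ-saturating: L_U is (ρ-1)-saturating, i.e. ρ is the least
    -- number of points of L_U needed to span every point.
    RankSaturating : ∀ {n k} → System n k → ℕ → Set
    RankSaturating S ρ = CoveredBy S ρ × (∀ s → s < ρ → CoveredBy S s → ⊥)

module Submission where

-- Fix an F_q-basis of U, so that U is F_q^n. If v ∈ F^k is an F-combination of u_1, …, u_ρ ∈ U, the
-- coordinate vectors of the u_i lie in the F-row space of a reduced row echelon ρ × n matrix E over F_q,
-- hence v is an F-combination of the ρ vectors E·(basis). Saturation therefore makes v ↦ (E, coefficients)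
-- injective, and since there are [n ρ]_q such matrices, q^(mk) ≤ [n ρ]_q q^(mρ).
-- For n = ρ + d one has [n ρ]_q ∏_{i≤ρ} (q^i - 1) ≤ q^(dρ) ∏_{i≤ρ} q^i, and ∏_{i≤ρ} q^i / (q^i - 1) is below
-- 2 ≤ q for q ≥ 3 and below 4 = q^2 for q = 2; comparing exponents of q gives the bounds on n.

open import Defs
open import Data.Nat using (ℕ; zero; suc; _∸_; _^_; _≤_; _<_; z≤n; s≤s)
open import Data.Nat.Properties using (<⇒≤)
open import Data.Fin using (Fin)
open import Data.Fin.Properties using (0↔⊥; 1↔⊤; +↔⊎; *↔×; injective⇒≤)
open import Data.Vec using (Vec)
open import Data.Product using (Σ; _×_; _,_; proj₁; proj₂; uncurry)
open import Data.Product.Function.NonDependent.Propositional using (_×-↔_)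
open import Data.Sum using (_⊎_; inj₁; inj₂)
open import Data.Sum.Function.Propositional using (_⊎-↔_)
open import Data.Unit using (⊤; tt)
open import Data.Empty using (⊥; ⊥-elim)
open import Relation.Binary.PropositionalEquality using (_≡_; refl)
open import Relation.Binary.Definitions using (DecidableEquality)
open import Function.Bundles using (_↔_; _↣_; Injection; mk↔ₛ′)
open import Function.Properties.Inverse using (↔-refl; ↔-sym; ↔-trans; ↔⇒↣)
open import Function.Properties.Injection using (↣-trans)

module Arithmetic where
  open import Data.Nat
  open import Data.Nat.Properties
  open import Data.Nat.DivMod using (m<n*o⇒m/o<n)
  open import Data.Nat.Tactic.RingSolver using (solve-∀)
  open import Relation.Binary.PropositionalEquality

  prod-suc : ∀ b f → prod (suc b) f ≡ f 0 * prod b (λ j → f (suc j))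
  prod-suc zero    f = *-comm 1 (f 0)
  prod-suc (suc b) f = trans (cong (_* f (suc b)) (prod-suc b f)) (*-assoc (f 0) _ _)

  prod-cong : ∀ b {f g} → (∀ j → j < b → f j ≡ g j) → prod b f ≡ prod b g
  prod-cong zero    f≡g = refl
  prod-cong (suc b) f≡g = cong₂ _*_ (prod-cong b (λ j j<b → f≡g j (m<n⇒m<1+n j<b))) (f≡g b ≤-refl)

  prod-mono-≤ : ∀ b {f g} → (∀ j → j < b → f j ≤ g j) → prod b f ≤ prod b g
  prod-mono-≤ zero    f≤g = ≤-refl
  prod-mono-≤ (suc b) f≤g = *-mono-≤ (prod-mono-≤ b (λ j j<b → f≤g j (m<n⇒m<1+n j<b))) (f≤g b ≤-refl)

  prod-distrib-* : ∀ b f g → prod b (λ j → f j * g j) ≡ prod b f * prod b g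
  prod-distrib-* zero    f g = refl
  prod-distrib-* (suc b) f g = trans (cong (_* (f b * g b)) (prod-distrib-* b f g)) (interchange (prod b f) (prod b g) (f b) (g b))
    where
    interchange : ∀ a b c d → a * b * (c * d) ≡ a * c * (b * d)
    interchange = solve-∀

  prod-const : ∀ b c → prod b (λ _ → c) ≡ c ^ b
  prod-const zero    c = refl
  prod-const (suc b) c = trans (cong (_* c) (prod-const b c)) (*-comm (c ^ b) c)

  prod-pos : ∀ b {f} → (∀ j → j < b → 0 < f j) → 0 < prod b f
  prod-pos zero    f>0 = z<s
  prod-pos (suc b) f>0 = *-mono-< (prod-pos b (λ j j<b → f>0 j (m<n⇒m<1+n j<b))) (f>0 b ≤-refl)

  prod-zero : ∀ b {f} j → j < b → f j ≡ 0 → prod b f ≡ 0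
  prod-zero (suc b) {f} j j<1+b fj≡0 with m≤n⇒m<n∨m≡n (s≤s⁻¹ j<1+b)
  ... | inj₁ j<b  = cong (_* f b) (prod-zero b j j<b fj≡0)
  ... | inj₂ refl = trans (cong (prod b f *_) fj≡0) (*-zeroʳ (prod b f))

  ratio-condition⇒ : ∀ s X Z → X * suc s ≤ s * Z → X * (suc Z + s) ≤ Z * (X + s)
  ratio-condition⇒ s X Z X[1+s]≤sZ = begin
      X * (suc Z + s)
    ≡⟨ split X Z s ⟩
      X * Z + X * suc s
    ≤⟨ +-monoʳ-≤ (X * Z) X[1+s]≤sZ ⟩
      X * Z + s * Z
    ≡⟨ collect X Z s ⟩
      Z * (X + s)
    ∎
    where
    open ≤-Reasoning
    split : ∀ x z s → x * (suc z + s) ≡ x * z + x * suc s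
    split = solve-∀
    collect : ∀ x z s → x * z + s * z ≡ z * (x + s)
    collect = solve-∀

  -- In rational terms: P / M ≤ c X / (X + s) and X (1 + s) ≤ s Z give (Z + 1) P / (Z M) ≤ c (Z + 1) / (Z + 1 + s).
  ratio-step : ∀ s c X Z P M → 0 < X → X * suc s ≤ s * Z → P * (X + s) ≤ c * X * M →
               suc Z * P * (suc Z + s) ≤ c * suc Z * (Z * M)
  ratio-step s c X@(suc _) Z P M _ X[1+s]≤sZ P[X+s]≤cXM = begin
      suc Z * P * (suc Z + s)
    ≡⟨ *-assoc (suc Z) P (suc Z + s) ⟩
      suc Z * (P * (suc Z + s))
    ≤⟨ *-monoʳ-≤ (suc Z) (*-cancelˡ-≤ X X*P[Z+1+s]≤X*cZM) ⟩
      suc Z * (c * Z * M)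
    ≡⟨ e₁ (suc Z) c Z M ⟩
      c * suc Z * (Z * M)
    ∎
    where
    open ≤-Reasoning
    e₁ : ∀ a c z m → a * (c * z * m) ≡ c * a * (z * m)
    e₁ = solve-∀
    e₂ : ∀ x p w → x * (p * w) ≡ p * (x * w)
    e₂ = solve-∀
    e₃ : ∀ z c x m → z * (c * x * m) ≡ x * (c * z * m)
    e₃ = solve-∀
    X*P[Z+1+s]≤X*cZM : X * (P * (suc Z + s)) ≤ X * (c * Z * M)
    X*P[Z+1+s]≤X*cZM = begin
        X * (P * (suc Z + s))
      ≡⟨ e₂ X P (suc Z + s) ⟩
        P * (X * (suc Z + s))
      ≤⟨ *-monoʳ-≤ P (ratio-condition⇒ s X Z X[1+s]≤sZ) ⟩
        P * (Z * (X + s))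
      ≡⟨ e₂ P Z (X + s) ⟩
        Z * (P * (X + s))
      ≤⟨ *-monoʳ-≤ Z P[X+s]≤cXM ⟩
        Z * (c * X * M)
      ≡⟨ e₃ Z c X M ⟩
        X * (c * Z * M)
      ∎

  ratio-bound⇒< : ∀ s c X P M → 0 < s → 0 < P → P * (X + s) ≤ c * X * M → P < c * M
  ratio-bound⇒< s c X P M s>0 P>0 P[X+s]≤cXM = *-cancelˡ-< X P (c * M) (begin-strict
      X * P
    ≡⟨ *-comm X P ⟩
      P * X
    <⟨ m<m+n (P * X) (*-mono-< P>0 s>0) ⟩
      P * X + P * s
    ≡⟨ sym (*-distribˡ-+ P X s) ⟩
      P * (X + s)
    ≤⟨ P[X+s]≤cXM ⟩
      c * X * M
    ≡⟨ rearrange c X M ⟩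
      X * (c * M)
    ∎)
    where
    open ≤-Reasoning
    rearrange : ∀ c x m → c * x * m ≡ x * (c * m)
    rearrange = solve-∀

  ratio-base : ∀ X → 2 ≤ X → 1 * X * (X + 2) ≤ 4 * X * (1 * (X ∸ 1))
  ratio-base (suc (suc w)) (s≤s (s≤s z≤n)) = subst (1 * (2 + w) * ((2 + w) + 2) ≤_) (slack w) (m≤m+n _ (3 * (2 + w) * w))
    where
    slack : ∀ w → 1 * (2 + w) * ((2 + w) + 2) + 3 * (2 + w) * w ≡ 4 * (2 + w) * (1 * (1 + w))
    slack = solve-∀

  ^-cancelʳ-≤ : ∀ a k ρ G → 0 < a → ρ ≤ k → a ^ k ≤ G * a ^ ρ → a ^ (k ∸ ρ) ≤ G
  ^-cancelʳ-≤ a k ρ G a>0 ρ≤k a^k≤Ga^ρ = *-cancelʳ-≤ (a ^ (k ∸ ρ)) G (a ^ ρ) {{a^ρ≢0}} (begin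
      a ^ (k ∸ ρ) * a ^ ρ
    ≡⟨ sym (^-distribˡ-+-* a (k ∸ ρ) ρ) ⟩
      a ^ (k ∸ ρ + ρ)
    ≡⟨ cong (a ^_) (m∸n+n≡m ρ≤k) ⟩
      a ^ k
    ≤⟨ a^k≤Ga^ρ ⟩
      G * a ^ ρ
    ∎)
    where
    open ≤-Reasoning
    a^ρ≢0 : NonZero (a ^ ρ)
    a^ρ≢0 = m^n≢0 a ρ {{>-nonZero a>0}}

  ceilDiv-≤ : ∀ x t r → x ≤ t * suc r → ceilDiv x (suc r) ≤ t
  ceilDiv-≤ x t r x≤t[1+r] = s≤s⁻¹ (m<n*o⇒m/o<n {x + suc r ∸ 1} {suc t} {suc r} (begin-strict
      x + suc r ∸ 1
    ≡⟨ cong (_∸ 1) (+-suc x r) ⟩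
      x + r
    <⟨ +-monoʳ-< x (n<1+n r) ⟩
      x + suc r
    ≤⟨ +-monoˡ-≤ (suc r) x≤t[1+r] ⟩
      t * suc r + suc r
    ≡⟨ +-comm (t * suc r) (suc r) ⟩
      suc t * suc r
    ∎))
    where open ≤-Reasoning

  -- From m (k - ρ) < e + 1 + d ρ: m k ≤ e + (d + m) ρ, so ⌈(m k - e) / ρ⌉ ≤ d + m.
  length-bound : ∀ m k d r e → suc r ≤ k → m * (k ∸ suc r) < suc e + d * suc r →
                 ceilDiv (m * k ∸ e) (suc r) + suc r ≤ suc r + d + m
  length-bound m k d r e ρ≤k exponent< = begin
      ceilDiv (m * k ∸ e) ρ + ρ
    ≤⟨ +-monoˡ-≤ ρ (ceilDiv-≤ (m * k ∸ e) (d + m) r mk∸e≤[d+m]ρ) ⟩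
      d + m + ρ
    ≡⟨ rotate d m ρ ⟩
      ρ + d + m
    ∎
    where
    open ≤-Reasoning
    ρ = suc r
    rotate : ∀ d m ρ → d + m + ρ ≡ ρ + d + m
    rotate = solve-∀
    collect : ∀ e d m ρ → e + d * ρ + m * ρ ≡ e + (d + m) * ρ
    collect = solve-∀
    mk≤e+[d+m]ρ : m * k ≤ e + (d + m) * ρ
    mk≤e+[d+m]ρ = begin
        m * k
      ≡⟨ cong (m *_) (sym (m∸n+n≡m ρ≤k)) ⟩
        m * (k ∸ ρ + ρ)
      ≡⟨ *-distribˡ-+ m (k ∸ ρ) ρ ⟩
        m * (k ∸ ρ) + m * ρ
      ≤⟨ +-monoˡ-≤ (m * ρ) (s≤s⁻¹ exponent<) ⟩
        e + d * ρ + m * ρ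
      ≡⟨ collect e d m ρ ⟩
        e + (d + m) * ρ
      ∎
    mk∸e≤[d+m]ρ : m * k ∸ e ≤ (d + m) * ρ
    mk∸e≤[d+m]ρ = subst (m * k ∸ e ≤_) (m+n∸m≡n e ((d + m) * ρ)) (∸-monoˡ-≤ e mk≤e+[d+m]ρ)

-- Reduced row echelon matrices with ρ rows, n columns and entries in A, split by their first column: either it
-- is zero, or it holds the first pivot and the first row carries one entry for each of the n ∸ ρ non-pivot
-- columns of the remaining rows.
Echelon : Set → ℕ → ℕ → Set
Echelon A zero    zero    = ⊤
Echelon A zero    (suc ρ) = ⊥
Echelon A (suc n) zero    = ⊤
Echelon A (suc n) (suc ρ) = Echelon A n (suc ρ) ⊎ (Echelon A n ρ × Vec A (n ∸ ρ))

Echelon⇒≤ : ∀ {A n ρ} → Echelon A n ρ → ρ ≤ n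
Echelon⇒≤ {n = zero}  {zero}  _                = z≤n
Echelon⇒≤ {n = suc n} {zero}  _                = z≤n
Echelon⇒≤ {n = suc n} {suc ρ} (inj₁ r)         = s≤s (<⇒≤ (Echelon⇒≤ r))
Echelon⇒≤ {n = suc n} {suc ρ} (inj₂ (r , _))   = s≤s (Echelon⇒≤ r)

module _ {A : Set} where
  open Data.Vec using ([]; _∷_; uncons)

  uncons-∸ : ∀ n ρ → ρ < n → Vec A (n ∸ ρ) → A × Vec A (n ∸ suc ρ)
  uncons-∸ (suc n) zero    _         (x ∷ xs) = x , xs
  uncons-∸ (suc n) (suc ρ) (s≤s ρ<n) xs       = uncons-∸ n ρ ρ<n xs

  cons-∸ : ∀ n ρ → ρ < n → A → Vec A (n ∸ suc ρ) → Vec A (n ∸ ρ)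
  cons-∸ (suc n) zero    _         x xs = x ∷ xs
  cons-∸ (suc n) (suc ρ) (s≤s ρ<n) x xs = cons-∸ n ρ ρ<n x xs

  uncons-cons-∸ : ∀ n ρ ρ<n (x : A) xs → uncons-∸ n ρ ρ<n (cons-∸ n ρ ρ<n x xs) ≡ (x , xs)
  uncons-cons-∸ (suc n) zero    _         x xs = refl
  uncons-cons-∸ (suc n) (suc ρ) (s≤s ρ<n) x xs = uncons-cons-∸ n ρ ρ<n x xs

  Vec↔Fin^ : ∀ {a} d → A ↔ Fin a → Vec A d ↔ Fin (a ^ d)
  Vec↔Fin^ zero    _  = ↔-trans (mk↔ₛ′ (λ _ → tt) (λ _ → []) (λ _ → refl) (λ { [] → refl })) (↔-sym 1↔⊤)
  Vec↔Fin^ (suc d) A↔ = ↔-trans (mk↔ₛ′ uncons (uncurry _∷_) (λ _ → refl) (λ { (x ∷ xs) → refl }))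
                                 (↔-trans (A↔ ×-↔ Vec↔Fin^ d A↔) (↔-sym *↔×))

↣⇒≤ : ∀ {A B : Set} {a b} → A ↔ Fin a → B ↔ Fin b → A ↣ B → a ≤ b
↣⇒≤ A↔ B↔ A↣B =
  injective⇒≤ (Injection.injective (↣-trans (↔⇒↣ (↔-sym A↔)) (↣-trans A↣B (↔⇒↣ B↔))))

module QBinomial (q : ℕ) where
  open import Data.Nat
  open import Data.Nat.Properties
  open import Data.Nat.DivMod using (m*n/n≡m)
  open import Data.Nat.Tactic.RingSolver using (solve-∀)
  open import Data.Product using (∃-syntax)
  open import Relation.Nullary using (yes; no)
  open import Relation.Binary.PropositionalEquality
  open Arithmetic

  qbinom : ℕ → ℕ → ℕ
  qbinom zero    zero    = 1
  qbinom zero    (suc ρ) = 0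
  qbinom (suc n) zero    = 1
  qbinom (suc n) (suc ρ) = qbinom n (suc ρ) + qbinom n ρ * q ^ (n ∸ ρ)

  Echelon↔Fin : ∀ {A : Set} → A ↔ Fin q → ∀ n ρ → Echelon A n ρ ↔ Fin (qbinom n ρ)
  Echelon↔Fin A↔ zero    zero    = ↔-sym 1↔⊤
  Echelon↔Fin A↔ zero    (suc ρ) = ↔-sym 0↔⊥
  Echelon↔Fin A↔ (suc n) zero    = ↔-sym 1↔⊤
  Echelon↔Fin A↔ (suc n) (suc ρ) = ↔-trans
    (Echelon↔Fin A↔ n (suc ρ) ⊎-↔ ↔-trans (Echelon↔Fin A↔ n ρ ×-↔ Vec↔Fin^ (n ∸ ρ) A↔) (↔-sym *↔×))
    (↔-sym +↔⊎)

  module _ (1<q : 1 < q) where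

    instance
      q-nonZero : NonZero q
      q-nonZero = >-nonZero (<-trans z<s 1<q)

    q^-pos : ∀ e → 0 < q ^ e
    q^-pos e = m^n>0 q e

    q^≡suc : ∀ e → ∃[ x ] q ^ e ≡ suc x
    q^≡suc e with q ^ e | q^-pos e
    ... | suc x | _ = x , refl

    qfall : ℕ → ℕ → ℕ
    qfall n ρ = prod ρ (λ j → q ^ (n ∸ j) ∸ 1)

    qfall-suc : ∀ n ρ → qfall (suc n) (suc ρ) ≡ (q ^ suc n ∸ 1) * qfall n ρ
    qfall-suc n ρ = prod-suc ρ (λ j → q ^ (suc n ∸ j) ∸ 1)

    qfall-< : ∀ n ρ → n < ρ → qfall n ρ ≡ 0
    qfall-< n ρ n<ρ = prod-zero ρ n n<ρ (cong (λ e → q ^ e ∸ 1) (n∸n≡0 n))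

    -- (q^(n-ρ) - 1) + q^(n-ρ) (q^(ρ+1) - 1) = q^(n+1) - 1; the first summand times qfall n ρ is qfall n (ρ + 1).
    qfall-pascal : ∀ n ρ →
      qfall n ρ * (q ^ (n ∸ ρ) ∸ 1) + q ^ (n ∸ ρ) * (q ^ suc ρ ∸ 1) * qfall n ρ ≡ (q ^ suc n ∸ 1) * qfall n ρ
    qfall-pascal n ρ with ρ ≤? n
    ... | no ρ≰n rewrite qfall-< n ρ (≰⇒> ρ≰n) =
      trans (*-zeroʳ (q ^ (n ∸ ρ) * (q ^ suc ρ ∸ 1))) (sym (*-zeroʳ (q ^ suc n ∸ 1)))
    ... | yes ρ≤n with q^≡suc (n ∸ ρ) | q^≡suc (suc ρ)
    ...   | a , q^a≡ | b , q^b≡ = begin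
        qfall n ρ * (q ^ (n ∸ ρ) ∸ 1) + q ^ (n ∸ ρ) * (q ^ suc ρ ∸ 1) * qfall n ρ
      ≡⟨ cong₂ (λ x y → qfall n ρ * (x ∸ 1) + x * (y ∸ 1) * qfall n ρ) q^a≡ q^b≡ ⟩
        qfall n ρ * a + suc a * b * qfall n ρ
      ≡⟨ collect (qfall n ρ) a b ⟩
        (suc a * suc b ∸ 1) * qfall n ρ
      ≡⟨ cong (λ x → (x ∸ 1) * qfall n ρ) (sym q^suc-n) ⟩
        (q ^ suc n ∸ 1) * qfall n ρ
      ∎
      where
      open ≡-Reasoning
      collect : ∀ X a b → X * a + (1 + a) * b * X ≡ (b + a * (1 + b)) * X
      collect = solve-∀
      q^suc-n : q ^ suc n ≡ suc a * suc b
      q^suc-n = begin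
          q ^ suc n
        ≡⟨ cong (q ^_) (sym (trans (+-suc (n ∸ ρ) ρ) (cong suc (m∸n+n≡m ρ≤n)))) ⟩
          q ^ (n ∸ ρ + suc ρ)
        ≡⟨ ^-distribˡ-+-* q (n ∸ ρ) (suc ρ) ⟩
          q ^ (n ∸ ρ) * q ^ suc ρ
        ≡⟨ cong₂ _*_ q^a≡ q^b≡ ⟩
          suc a * suc b
        ∎

    qbinom-*-qfall : ∀ n ρ → qbinom n ρ * qfall ρ ρ ≡ qfall n ρ
    qbinom-*-qfall zero    zero    = refl
    qbinom-*-qfall zero    (suc ρ) = sym (qfall-< 0 (suc ρ) z<s)
    qbinom-*-qfall (suc n) zero    = refl
    qbinom-*-qfall (suc n) (suc ρ) = begin
        (qbinom n (suc ρ) + qbinom n ρ * x) * qfall (suc ρ) (suc ρ)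
      ≡⟨ cong ((qbinom n (suc ρ) + qbinom n ρ * x) *_) (qfall-suc ρ ρ) ⟩
        (qbinom n (suc ρ) + qbinom n ρ * x) * (y * qfall ρ ρ)
      ≡⟨ expand (qbinom n (suc ρ)) (qbinom n ρ) x y (qfall ρ ρ) ⟩
        qbinom n (suc ρ) * (y * qfall ρ ρ) + x * y * (qbinom n ρ * qfall ρ ρ)
      ≡⟨ cong₂ (λ u v → qbinom n (suc ρ) * u + x * y * v) (sym (qfall-suc ρ ρ)) (qbinom-*-qfall n ρ) ⟩
        qbinom n (suc ρ) * qfall (suc ρ) (suc ρ) + x * y * qfall n ρ
      ≡⟨ cong (_+ x * y * qfall n ρ) (qbinom-*-qfall n (suc ρ)) ⟩
        qfall n (suc ρ) + x * y * qfall n ρ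
      ≡⟨ qfall-pascal n ρ ⟩
        (q ^ suc n ∸ 1) * qfall n ρ
      ≡⟨ sym (qfall-suc n ρ) ⟩
        qfall (suc n) (suc ρ)
      ∎
      where
      open ≡-Reasoning
      x = q ^ (n ∸ ρ)
      y = q ^ suc ρ ∸ 1
      expand : ∀ g₁ g₀ x y z → (g₁ + g₀ * x) * (y * z) ≡ g₁ * (y * z) + x * y * (g₀ * z)
      expand = solve-∀

    q^n∸q^j≡q^j*[q^[n∸j]∸1] : ∀ n j → q ^ n ∸ q ^ j ≡ q ^ j * (q ^ (n ∸ j) ∸ 1)
    q^n∸q^j≡q^j*[q^[n∸j]∸1] n j with j ≤? n
    ... | yes j≤n = begin
        q ^ n ∸ q ^ j
      ≡⟨ cong₂ _∸_ (trans (cong (q ^_) (sym (m+[n∸m]≡n j≤n))) (^-distribˡ-+-* q j (n ∸ j)))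
                   (sym (*-identityʳ (q ^ j))) ⟩
        q ^ j * q ^ (n ∸ j) ∸ q ^ j * 1
      ≡⟨ sym (*-distribˡ-∸ (q ^ j) (q ^ (n ∸ j)) 1) ⟩
        q ^ j * (q ^ (n ∸ j) ∸ 1)
      ∎
      where open ≡-Reasoning
    ... | no j≰n = begin
        q ^ n ∸ q ^ j
      ≡⟨ m≤n⇒m∸n≡0 (^-monoʳ-≤ q (<⇒≤ (≰⇒> j≰n))) ⟩
        0
      ≡⟨ sym (*-zeroʳ (q ^ j)) ⟩
        q ^ j * 0
      ≡⟨ cong (λ e → q ^ j * (q ^ e ∸ 1)) (sym (m≤n⇒m∸n≡0 (<⇒≤ (≰⇒> j≰n)))) ⟩
        q ^ j * (q ^ (n ∸ j) ∸ 1)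
      ∎
      where open ≡-Reasoning

    gauss-numerator : ∀ n ρ → prod ρ (λ j → q ^ n ∸ q ^ j) ≡ prod ρ (q ^_) * qfall n ρ
    gauss-numerator n ρ =
      trans (prod-cong ρ (λ j _ → q^n∸q^j≡q^j*[q^[n∸j]∸1] n j))
            (prod-distrib-* ρ (q ^_) (λ j → q ^ (n ∸ j) ∸ 1))

    gauss≡qbinom : ∀ n ρ → gauss q n ρ ≡ qbinom n ρ
    gauss≡qbinom n ρ = begin
        div (prod ρ (λ j → q ^ n ∸ q ^ j)) D
      ≡⟨ cong (λ x → div x D) numerator≡ ⟩
        div (qbinom n ρ * D) D
      ≡⟨ div-*-cancel (qbinom n ρ) D-pos ⟩
        qbinom n ρ
      ∎
      where
      open ≡-Reasoning
      D = prod ρ (λ j → q ^ ρ ∸ q ^ j)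
      D-pos : 0 < D
      D-pos = prod-pos ρ (λ j j<ρ → m<n⇒0<n∸m (^-monoʳ-< q 1<q j<ρ))
      div-*-cancel : ∀ g {d} → 0 < d → div (g * d) d ≡ g
      div-*-cancel g {suc d} _ = m*n/n≡m g (suc d)
      swap : ∀ a b c → a * (b * c) ≡ b * (a * c)
      swap = solve-∀
      numerator≡ : prod ρ (λ j → q ^ n ∸ q ^ j) ≡ qbinom n ρ * D
      numerator≡ = begin
          prod ρ (λ j → q ^ n ∸ q ^ j)
        ≡⟨ gauss-numerator n ρ ⟩
          prod ρ (q ^_) * qfall n ρ
        ≡⟨ cong (prod ρ (q ^_) *_) (sym (qbinom-*-qfall n ρ)) ⟩
          prod ρ (q ^_) * (qbinom n ρ * qfall ρ ρ)
        ≡⟨ swap (prod ρ (q ^_)) (qbinom n ρ) (qfall ρ ρ) ⟩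
          qbinom n ρ * (prod ρ (q ^_) * qfall ρ ρ)
        ≡⟨ cong (qbinom n ρ *_) (sym (gauss-numerator ρ ρ)) ⟩
          qbinom n ρ * D
        ∎

    qtri : ℕ → ℕ
    qtri ρ = prod ρ (λ j → q ^ (ρ ∸ j))

    qtri-pos : ∀ ρ → 0 < qtri ρ
    qtri-pos ρ = prod-pos ρ (λ j _ → q^-pos (ρ ∸ j))

    qtri-suc : ∀ ρ → qtri (suc ρ) ≡ q ^ suc ρ * qtri ρ
    qtri-suc ρ = prod-suc ρ (λ j → q ^ (suc ρ ∸ j))

    qfall≤q^*qtri : ∀ d ρ → qfall (ρ + d) ρ ≤ q ^ (d * ρ) * qtri ρ
    qfall≤q^*qtri d ρ = begin
        qfall (ρ + d) ρ
      ≤⟨ prod-mono-≤ ρ (λ j _ → m∸n≤m (q ^ (ρ + d ∸ j)) 1) ⟩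
        prod ρ (λ j → q ^ (ρ + d ∸ j))
      ≡⟨ prod-cong ρ (λ j j<ρ → cong (q ^_) (trans (cong (_∸ j) (+-comm ρ d)) (+-∸-assoc d (<⇒≤ j<ρ)))) ⟩
        prod ρ (λ j → q ^ (d + (ρ ∸ j)))
      ≡⟨ prod-cong ρ (λ j _ → ^-distribˡ-+-* q d (ρ ∸ j)) ⟩
        prod ρ (λ j → q ^ d * q ^ (ρ ∸ j))
      ≡⟨ prod-distrib-* ρ (λ _ → q ^ d) (λ j → q ^ (ρ ∸ j)) ⟩
        prod ρ (λ _ → q ^ d) * qtri ρ
      ≡⟨ cong (_* qtri ρ) (trans (prod-const ρ (q ^ d)) (^-*-assoc q d ρ)) ⟩
        q ^ (d * ρ) * qtri ρ
      ∎
      where open ≤-Reasoning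

    qbinom< : ∀ d ρ c → qtri ρ < c * qfall ρ ρ → qbinom (ρ + d) ρ < c * q ^ (d * ρ)
    qbinom< d ρ c qtri< = *-cancelʳ-< (qfall ρ ρ) _ _ (begin-strict
        qbinom (ρ + d) ρ * qfall ρ ρ
      ≡⟨ qbinom-*-qfall (ρ + d) ρ ⟩
        qfall (ρ + d) ρ
      ≤⟨ qfall≤q^*qtri d ρ ⟩
        q ^ (d * ρ) * qtri ρ
      <⟨ *-monoʳ-< (q ^ (d * ρ)) {{m^n≢0 q (d * ρ)}} qtri< ⟩
        q ^ (d * ρ) * (c * qfall ρ ρ)
      ≡⟨ rearrange (q ^ (d * ρ)) c (qfall ρ ρ) ⟩
        c * q ^ (d * ρ) * qfall ρ ρ
      ∎)
      where
      open ≤-Reasoning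
      rearrange : ∀ x c y → x * (c * y) ≡ c * x * y
      rearrange = solve-∀

    qtri-ratio-suc : ∀ s c ρ → q ^ ρ * suc s ≤ s * (q ^ suc ρ ∸ 1) →
      qtri ρ * (q ^ ρ + s) ≤ c * q ^ ρ * qfall ρ ρ →
      qtri (suc ρ) * (q ^ suc ρ + s) ≤ c * q ^ suc ρ * qfall (suc ρ) (suc ρ)
    qtri-ratio-suc s c ρ cond ratio rewrite qtri-suc ρ | qfall-suc ρ ρ with q^≡suc (suc ρ)
    ... | Z , q^≡1+Z rewrite q^≡1+Z = ratio-step s c (q ^ ρ) Z (qtri ρ) (qfall ρ ρ) (q^-pos ρ) cond ratio

    ratio-condition₁ : 3 ≤ q → ∀ ρ → q ^ ρ * 2 ≤ 1 * (q ^ suc ρ ∸ 1)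
    ratio-condition₁ 3≤q ρ = subst (q ^ ρ * 2 ≤_) (sym (*-identityˡ _)) (m+n≤o⇒m≤o∸n (q ^ ρ * 2) (begin
        q ^ ρ * 2 + 1
      ≤⟨ +-monoʳ-≤ (q ^ ρ * 2) (q^-pos ρ) ⟩
        q ^ ρ * 2 + q ^ ρ
      ≡⟨ e (q ^ ρ) ⟩
        3 * q ^ ρ
      ≤⟨ *-monoˡ-≤ (q ^ ρ) 3≤q ⟩
        q ^ suc ρ
      ∎))
      where
      open ≤-Reasoning
      e : ∀ x → x * 2 + x ≡ 3 * x
      e = solve-∀

    ratio-condition₂ : ∀ ρ → q ^ suc ρ * 3 ≤ 2 * (q ^ suc (suc ρ) ∸ 1)
    ratio-condition₂ ρ = subst (Y * 3 ≤_) (sym (*-distribˡ-∸ 2 (q ^ suc (suc ρ)) 1)) (m+n≤o⇒m≤o∸n (Y * 3) (begin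
        Y * 3 + 2
      ≤⟨ +-monoʳ-≤ (Y * 3) (≤-trans 1<q (m≤m*n q (q ^ ρ) {{m^n≢0 q ρ}})) ⟩
        Y * 3 + Y
      ≡⟨ e Y ⟩
        2 * (2 * Y)
      ≤⟨ *-monoʳ-≤ 2 (*-monoˡ-≤ Y 1<q) ⟩
        2 * q ^ suc (suc ρ)
      ∎))
      where
      open ≤-Reasoning
      Y = q ^ suc ρ
      e : ∀ y → y * 3 + y ≡ 2 * (2 * y)
      e = solve-∀

    -- Invariants bounding qtri ρ / qfall ρ ρ = ∏_{i≤ρ} q^i / (q^i - 1) by c q^ρ / (q^ρ + s) < c.
    qtri-ratio₁ : 3 ≤ q → ∀ ρ → qtri ρ * (q ^ ρ + 1) ≤ 2 * q ^ ρ * qfall ρ ρ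
    qtri-ratio₁ 3≤q zero    = ≤-refl
    qtri-ratio₁ 3≤q (suc ρ) = qtri-ratio-suc 1 2 ρ (ratio-condition₁ 3≤q ρ) (qtri-ratio₁ 3≤q ρ)

    qtri-ratio₂ : ∀ ρ → qtri (suc ρ) * (q ^ suc ρ + 2) ≤ 4 * q ^ suc ρ * qfall (suc ρ) (suc ρ)
    qtri-ratio₂ zero    = ratio-base (q ^ 1) (≤-trans 1<q (m≤m*n q 1))
    qtri-ratio₂ (suc ρ) = qtri-ratio-suc 2 4 (suc ρ) (ratio-condition₂ ρ) (qtri-ratio₂ ρ)

    qtri<q*qfall : 3 ≤ q → ∀ ρ → qtri ρ < q * qfall ρ ρ
    qtri<q*qfall 3≤q ρ = <-≤-trans
      (ratio-bound⇒< 1 2 (q ^ ρ) (qtri ρ) (qfall ρ ρ) z<s (qtri-pos ρ) (qtri-ratio₁ 3≤q ρ))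
      (*-monoˡ-≤ (qfall ρ ρ) 1<q)

    qtri<4*qfall : ∀ ρ → qtri ρ < 4 * qfall ρ ρ
    qtri<4*qfall zero    = s≤s (s≤s z≤n)
    qtri<4*qfall (suc ρ) =
      ratio-bound⇒< 2 4 (q ^ suc ρ) (qtri (suc ρ)) (qfall (suc ρ) (suc ρ)) z<s (qtri-pos (suc ρ)) (qtri-ratio₂ ρ)

    qbinom-1< : ∀ d → qbinom (suc d) 1 < q ^ suc d
    qbinom-1< zero    = subst (1 <_) (sym (*-identityʳ q)) 1<q
    qbinom-1< (suc d) = begin-strict
        qbinom (suc d) 1 + 1 * q ^ suc d
      <⟨ +-monoˡ-< (1 * q ^ suc d) (qbinom-1< d) ⟩
        2 * q ^ suc d
      ≤⟨ *-monoˡ-≤ (q ^ suc d) 1<q ⟩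
        q ^ suc (suc d)
      ∎
      where open ≤-Reasoning

    q^<q^⇒< : ∀ {a b} → q ^ a < q ^ b → a < b
    q^<q^⇒< q^a<q^b = ≰⇒> (λ b≤a → <⇒≱ q^a<q^b (^-monoʳ-≤ q b≤a))

    dimension-bounds : ∀ m n k ρ → 1 ≤ ρ → ρ ≤ k → ρ ≤ n → (q ^ m) ^ k ≤ qbinom n ρ * (q ^ m) ^ ρ →
        (gauss q n ρ ≥ q ^ (m * (k ∸ ρ)))
        × (2 < q → n + m ≥ ceilDiv (m * k) ρ + ρ)
        × (q ≡ 2 → 1 < ρ → n + m ≥ ceilDiv (m * k ∸ 1) ρ + ρ)
        × (q ≡ 2 → ρ ≡ 1 → n ≥ m * (k ∸ 1) + 1)
    dimension-bounds m n k ρ@(suc r) _ ρ≤k ρ≤n count with m≤n⇒∃[o]m+o≡n ρ≤n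
    ... | d , refl =
      subst (q ^ (m * (k ∸ ρ)) ≤_) (sym (gauss≡qbinom n ρ)) q^≤qbinom , q>2-bound , q≡2-bound , ρ≡1-bound
      where
      q^≤qbinom : q ^ (m * (k ∸ ρ)) ≤ qbinom n ρ
      q^≤qbinom = subst (_≤ qbinom n ρ) (^-*-assoc q m (k ∸ ρ))
                        (^-cancelʳ-≤ (q ^ m) k ρ (qbinom n ρ) (q^-pos m) ρ≤k count)
      q>2-bound : 2 < q → n + m ≥ ceilDiv (m * k) ρ + ρ
      q>2-bound 2<q = length-bound m k d r 0 ρ≤k
        (q^<q^⇒< (≤-<-trans q^≤qbinom (qbinom< d ρ q (qtri<q*qfall 2<q ρ))))
      q≡2-bound : q ≡ 2 → 1 < ρ → n + m ≥ ceilDiv (m * k ∸ 1) ρ + ρ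
      q≡2-bound q≡2 _ = length-bound m k d r 1 ρ≤k
        (q^<q^⇒< (≤-<-trans q^≤qbinom (subst (qbinom n ρ <_) 4≡q*q (qbinom< d ρ 4 (qtri<4*qfall ρ)))))
        where
        4≡q*q : 4 * q ^ (d * ρ) ≡ q * (q * q ^ (d * ρ))
        4≡q*q = trans (*-assoc 2 2 (q ^ (d * ρ))) (cong (λ t → t * (t * q ^ (d * ρ))) (sym q≡2))
      ρ≡1-bound : q ≡ 2 → ρ ≡ 1 → n ≥ m * (k ∸ 1) + 1
      ρ≡1-bound _ refl = subst (_≤ suc d) (+-comm 1 (m * (k ∸ 1))) (q^<q^⇒< (≤-<-trans q^≤qbinom (qbinom-1< d)))

module LinearAlgebra (F : Field) where
  open import Level using (0ℓ)
  open import Data.Fin using (zero; suc)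
  open import Data.Vec using (lookup; map)
  open import Data.Vec.Properties using (lookup-map; lookup-zipWith; lookup-replicate; tabulate∘lookup; tabulate-cong)
  open import Algebra.Bundles using (CommutativeRing)
  open import Relation.Binary.PropositionalEquality

  open Field F

  ring : CommutativeRing 0ℓ 0ℓ
  ring = record { isCommutativeRing = isCommutativeRing }

  open CommutativeRing ring public
    using (+-identityˡ; +-identityʳ; *-identityˡ; *-identityʳ; *-assoc; *-comm; zeroˡ; zeroʳ; semiring)
  open import Algebra.Properties.Semiring.Sum semiring public
    using (sum-syntax; sum-cong-≗; ∑-comm; ∑-distrib-+; *-distribˡ-sum; *-distribʳ-sum; sum-replicate-zero)

  open CommutativeRing ring using (commutativeSemiring)
  open import Algebra.Solver.Ring.NaturalCoefficients.Default commutativeSemiring public using (solve; _:=_; _:+_; _:*_)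

  Vec-ext : ∀ {k} {v w : Vec Carrier k} → (∀ x → lookup v x ≡ lookup w x) → v ≡ w
  Vec-ext {v = v} {w} v≗w = trans (sym (tabulate∘lookup v)) (trans (tabulate-cong v≗w) (tabulate∘lookup w))

  lookup-lincomb : ∀ {k t} (c : Fin t → Carrier) (w : Fin t → V F k) x →
                   lookup (lincomb F c w) x ≡ ∑[ j < t ] (c j * lookup (w j) x)
  lookup-lincomb {t = zero}  c w x = lookup-replicate x 0#
  lookup-lincomb {t = suc t} c w x = trans (lookup-zipWith _+_ x (map (c zero *_) (w zero)) _)
    (cong₂ _+_ (lookup-map x (c zero *_) (w zero)) (lookup-lincomb (λ j → c (suc j)) (λ j → w (suc j)) x))

  lincomb-cong : ∀ {k t} {c c' : Fin t → Carrier} {w w' : Fin t → V F k} →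
                 (∀ j → c j ≡ c' j) → (∀ j → w j ≡ w' j) → lincomb F c w ≡ lincomb F c' w'
  lincomb-cong {t = zero}  c≗c' w≗w' = refl
  lincomb-cong {t = suc t} c≗c' w≗w' =
    cong₂ (_⊕_ F) (cong₂ (_·_ F) (c≗c' zero) (w≗w' zero))
                  (lincomb-cong (λ j → c≗c' (suc j)) (λ j → w≗w' (suc j)))

  lincomb-zero : ∀ {k t} (w : Fin t → V F k) → lincomb F (λ _ → 0#) w ≡ 0v F
  lincomb-zero {t = t} w = Vec-ext λ x → begin
      lookup (lincomb F (λ _ → 0#) w) x
    ≡⟨ lookup-lincomb (λ _ → 0#) w x ⟩
      ∑[ j < t ] (0# * lookup (w j) x)
    ≡⟨ sum-cong-≗ {t} (λ j → zeroˡ (lookup (w j) x)) ⟩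
      ∑[ j < t ] 0#
    ≡⟨ sum-replicate-zero t ⟩
      0#
    ≡⟨ sym (lookup-replicate x 0#) ⟩
      lookup (0v F) x
    ∎
    where open ≡-Reasoning

  lincomb-lincomb : ∀ {k s t} (c : Fin s → Carrier) (β : Fin s → Fin t → Carrier) (w : Fin t → V F k) →
    lincomb F c (λ i → lincomb F (β i) w) ≡ lincomb F (λ j → ∑[ i < s ] (c i * β i j)) w
  lincomb-lincomb {s = s} {t} c β w = Vec-ext λ x → begin
      lookup (lincomb F c (λ i → lincomb F (β i) w)) x
    ≡⟨ lookup-lincomb c _ x ⟩
      ∑[ i < s ] (c i * lookup (lincomb F (β i) w) x)
    ≡⟨ sum-cong-≗ {s} (λ i → trans (cong (c i *_) (lookup-lincomb (β i) w x)) (*-distribˡ-sum {t} (c i) _)) ⟩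
      ∑[ i < s ] ∑[ j < t ] (c i * (β i j * lookup (w j) x))
    ≡⟨ ∑-comm {s} {t} _ ⟩
      ∑[ j < t ] ∑[ i < s ] (c i * (β i j * lookup (w j) x))
    ≡⟨ sum-cong-≗ {t} (λ j → trans (sum-cong-≗ {s} (λ i → sym (*-assoc (c i) (β i j) _)))
                                   (sym (*-distribʳ-sum {s} _ _))) ⟩
      ∑[ j < t ] (∑[ i < s ] (c i * β i j) * lookup (w j) x)
    ≡⟨ sym (lookup-lincomb _ w x) ⟩
      lookup (lincomb F (λ j → ∑[ i < s ] (c i * β i j)) w) x
    ∎
    where open ≡-Reasoning

module RowReduction (F : Field) {q : ℕ} (K : Subfield F q) (_≟_ : DecidableEquality (Field.Carrier F)) where
  open import Data.Fin using (zero; suc; punchIn; punchOut)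
  open import Data.Fin.Properties using (any?; punchIn-punchOut) renaming (_≟_ to _≟ᶠ_)
  open import Data.Nat.Properties using (n∸n≡0; m≤n⇒m<n∨m≡n)
  open import Data.Vec using ([]; lookup; tabulate)
  open import Data.Vec.Properties using (lookup∘tabulate)
  open import Data.Vec.Functional using (Vector; _∷_)
  open import Data.Product using (∃-syntax)
  open import Relation.Nullary using (yes; no; ¬?)
  open import Relation.Nullary.Decidable using (decidable-stable)
  open import Function using (_∘_)
  open import Relation.Binary.PropositionalEquality

  open Field F
  open Subfield K
  open LinearAlgebra F
  open import Algebra.Bundles using (CommutativeRing)
  open import Algebra.Properties.Group (CommutativeRing.+-group ring) using (//-rightDividesˡ; ε⁻¹≈ε)

  infixl 6 _-_
  _-_ : Carrier → Carrier → Carrier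
  x - y = x + - y

  InK : Carrier → Set
  InK x = ∃[ a ] ι a ≡ x

  AllInK : ∀ {n} → Vector Carrier n → Set
  AllInK z = ∀ l → InK (z l)

  InK-minus : ∀ {x y} → InK x → InK y → InK (x - y)
  InK-minus (a , refl) (b , refl) with has-neg b
  ... | c , ιc≡-ιb with has-+ a c
  ...   | d , ιd≡ιa+ιc = d , trans ιd≡ιa+ιc (cong (ι a +_) ιc≡-ιb)

  InK-* : ∀ {x y} → InK x → InK y → InK (x * y)
  InK-* (a , refl) (b , refl) = has-* a b

  InK-⁻¹ : ∀ {x} → InK x → x ≢ 0# → InK (x ⁻¹)
  InK-⁻¹ (a , refl) = has-inv a

  InRowSpan : ∀ {ρ n} → (Fin ρ → Vector Carrier n) → Vector Carrier n → Set
  InRowSpan {ρ} R z = Σ (Fin ρ → Carrier) λ c → ∀ l → z l ≡ ∑[ j < ρ ] (c j * R j l)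

  InRowSpan-resp : ∀ {ρ n} {R : Fin ρ → Vector Carrier n} {z z'} →
                   (∀ l → z l ≡ z' l) → InRowSpan R z' → InRowSpan R z
  InRowSpan-resp z≗z' (c , z'≗) = c , λ l → trans (z≗z' l) (z'≗ l)

  InRowSpan-+* : ∀ {ρ n} {R : Fin ρ → Vector Carrier n} {z₁ z₂} a →
                 InRowSpan R z₁ → InRowSpan R z₂ → InRowSpan R (λ l → z₁ l + a * z₂ l)
  InRowSpan-+* {ρ} {R = R} {z₁} {z₂} a (c₁ , z₁≗) (c₂ , z₂≗) = (λ j → c₁ j + a * c₂ j) , λ l → begin
      z₁ l + a * z₂ l
    ≡⟨ cong₂ (λ u v → u + a * v) (z₁≗ l) (z₂≗ l) ⟩
      ∑[ j < ρ ] (c₁ j * R j l) + a * ∑[ j < ρ ] (c₂ j * R j l)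
    ≡⟨ cong (∑[ j < ρ ] (c₁ j * R j l) +_) (*-distribˡ-sum {ρ} a _) ⟩
      ∑[ j < ρ ] (c₁ j * R j l) + ∑[ j < ρ ] (a * (c₂ j * R j l))
    ≡⟨ sym (∑-distrib-+ {ρ} _ _) ⟩
      ∑[ j < ρ ] (c₁ j * R j l + a * (c₂ j * R j l))
    ≡⟨ sum-cong-≗ {ρ} (λ j → collect (c₁ j) (c₂ j) a (R j l)) ⟩
      ∑[ j < ρ ] ((c₁ j + a * c₂ j) * R j l)
    ∎
    where
    open ≡-Reasoning
    collect : ∀ c₁ c₂ a r → c₁ * r + a * (c₂ * r) ≡ (c₁ + a * c₂) * r
    collect = solve 4 (λ c₁ c₂ a r → c₁ :* r :+ a :* (c₂ :* r) := (c₁ :+ a :* c₂) :* r) refl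

  InRowSpan-scale : ∀ {ρ n} {R : Fin ρ → Vector Carrier n} {z} a → InRowSpan R z → InRowSpan R (λ l → a * z l)
  InRowSpan-scale {ρ} {R = R} a (c , z≗) = (λ j → a * c j) , λ l →
    trans (cong (a *_) (z≗ l)) (trans (*-distribˡ-sum {ρ} a _) (sum-cong-≗ {ρ} (λ j → sym (*-assoc a (c j) (R j l)))))

  x-0*a≡x : ∀ x a → x - 0# * a ≡ x
  x-0*a≡x x a = trans (cong (λ b → x + - b) (zeroˡ a)) (trans (cong (x +_) ε⁻¹≈ε) (+-identityʳ x))

  ∑-*-0 : ∀ t (c : Fin t → Carrier) → ∑[ j < t ] (c j * 0#) ≡ 0#
  ∑-*-0 t c = trans (sum-cong-≗ {t} (λ j → zeroʳ (c j))) (sum-replicate-zero t)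

  -- The entries of y at the non-pivot columns of r, and 0 at its pivot columns.
  offPivot : ∀ {n ρ} → Echelon (Fin q) n ρ → Vec (Fin q) (n ∸ ρ) → Vector Carrier n
  offPivot {ρ = zero}      _              y l = ι (lookup y l)
  offPivot {suc n} {suc ρ} (inj₁ r)       y   = ι (proj₁ y') ∷ offPivot r (proj₂ y')
    where y' = uncons-∸ n ρ (Echelon⇒≤ r) y
  offPivot {suc n} {suc ρ} (inj₂ (r , _)) y   = 0# ∷ offPivot r y

  rows : ∀ {n ρ} → Echelon (Fin q) n ρ → Fin ρ → Vector Carrier n
  rows {suc n} {suc ρ} (inj₁ r)       j = 0# ∷ rows r j
  rows {suc n} {suc ρ} (inj₂ (r , y))   = (1# ∷ offPivot r y) ∷ (λ j → 0# ∷ rows r j)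

  offPivot-InK : ∀ {n ρ} (r : Echelon (Fin q) n ρ) y → AllInK (offPivot r y)
  offPivot-InK {ρ = zero}      _              y l       = _ , refl
  offPivot-InK {suc n} {suc ρ} (inj₁ r)       y zero    = _ , refl
  offPivot-InK {suc n} {suc ρ} (inj₁ r)       y (suc l) = offPivot-InK r _ l
  offPivot-InK {suc n} {suc ρ} (inj₂ (r , _)) y zero    = has-0
  offPivot-InK {suc n} {suc ρ} (inj₂ (r , _)) y (suc l) = offPivot-InK r y l

  offPivot-cons : ∀ {n ρ} (r : Echelon (Fin q) n (suc ρ)) a y l →
    offPivot {suc n} {suc ρ} (inj₁ r) (cons-∸ n ρ (Echelon⇒≤ r) a y) l ≡ (ι a ∷ offPivot r y) l
  offPivot-cons {n} {ρ} r a y l rewrite uncons-cons-∸ n ρ (Echelon⇒≤ r) a y = refl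

  -- Clearing the first column of z with the pivot row of inj₂ (r , y).
  pivot-step : ∀ {n ρ} (r : Echelon (Fin q) n ρ) y (z : Vector Carrier (suc n)) e c →
    (∀ l → z (suc l) - z zero * offPivot r y l ≡ e l + ∑[ j < ρ ] (c j * rows r j l)) →
    ∀ l → z l ≡ (0# ∷ e) l + ∑[ j < suc ρ ] ((z zero ∷ c) j * rows {suc n} {suc ρ} (inj₂ (r , y)) j l)
  pivot-step {ρ = ρ} r y z e c _ zero = sym (begin
      0# + (z zero * 1# + ∑[ j < ρ ] (c j * 0#))
    ≡⟨ +-identityˡ _ ⟩
      z zero * 1# + ∑[ j < ρ ] (c j * 0#)
    ≡⟨ cong (z zero * 1# +_) (∑-*-0 ρ c) ⟩
      z zero * 1# + 0#
    ≡⟨ +-identityʳ _ ⟩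
      z zero * 1#
    ≡⟨ *-identityʳ (z zero) ⟩
      z zero
    ∎)
    where open ≡-Reasoning
  pivot-step {ρ = ρ} r y z e c reduced (suc l) = begin
      z (suc l)
    ≡⟨ sym (//-rightDividesˡ a (z (suc l))) ⟩
      z (suc l) - a + a
    ≡⟨ cong (_+ a) (reduced l) ⟩
      e l + S + a
    ≡⟨ shuffle (e l) S a ⟩
      e l + (a + S)
    ∎
    where
    open ≡-Reasoning
    a = z zero * offPivot r y l
    S = ∑[ j < ρ ] (c j * rows r j l)
    shuffle : ∀ e s a → e + s + a ≡ e + (a + s)
    shuffle = solve 3 (λ e s a → e :+ s :+ a := e :+ (a :+ s)) refl

  pivot-span : ∀ {n ρ} (r : Echelon (Fin q) n ρ) y (z : Vector Carrier (suc n)) →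
    InRowSpan (rows r) (λ l → z (suc l) - z zero * offPivot r y l) →
    InRowSpan (rows {suc n} {suc ρ} (inj₂ (r , y))) z
  pivot-span r y z (c , reduced) = (z zero ∷ c) , λ l →
    trans (pivot-step r y z (λ _ → 0#) c (λ l → trans (reduced l) (sym (+-identityˡ _))) l) (0∷0+ l)
    where
    0∷0+ : ∀ {x} l → (0# ∷ (λ (_ : Fin _) → 0#)) l + x ≡ x
    0∷0+ zero    = +-identityˡ _
    0∷0+ (suc l) = +-identityˡ _

  Reduces : ∀ {n ρ} → Echelon (Fin q) n ρ → Vector Carrier n → Vec (Fin q) (n ∸ ρ) → Set
  Reduces {ρ = ρ} r z y = Σ (Fin ρ → Carrier) λ c → ∀ l → z l ≡ offPivot r y l + ∑[ j < ρ ] (c j * rows r j l)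

  reduce : ∀ {n ρ} (r : Echelon (Fin q) n ρ) (z : Vector Carrier n) → AllInK z → Σ (Vec (Fin q) (n ∸ ρ)) (Reduces r z)
  reduce {ρ = zero} r z z∈K = tabulate (λ l → proj₁ (z∈K l)) , (λ ()) , λ l → sym (begin
      ι (lookup (tabulate (λ l → proj₁ (z∈K l))) l) + 0#
    ≡⟨ +-identityʳ _ ⟩
      ι (lookup (tabulate (λ l → proj₁ (z∈K l))) l)
    ≡⟨ cong ι (lookup∘tabulate (λ l → proj₁ (z∈K l)) l) ⟩
      ι (proj₁ (z∈K l))
    ≡⟨ proj₂ (z∈K l) ⟩
      z l
    ∎)
    where open ≡-Reasoning
  reduce {suc n} {suc ρ} (inj₁ r) z z∈K with reduce r (λ l → z (suc l)) (λ l → z∈K (suc l))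
  ... | y , c , reduced =
    cons-∸ n ρ (Echelon⇒≤ r) a y , c , λ l → trans (reduced′ l) (cong (_+ _) (sym (offPivot-cons r a y l)))
    where
    a = proj₁ (z∈K zero)
    reduced′ : ∀ l → z l ≡ (ι a ∷ offPivot r y) l + ∑[ j < suc ρ ] (c j * rows {suc n} {suc ρ} (inj₁ r) j l)
    reduced′ zero    = sym (trans (cong (ι a +_) (∑-*-0 (suc ρ) c)) (trans (+-identityʳ _) (proj₂ (z∈K zero))))
    reduced′ (suc l) = reduced l
  reduce {suc n} {suc ρ} (inj₂ (r , y₀)) z z∈K
    with reduce r (λ l → z (suc l) - z zero * offPivot r y₀ l)
                  (λ l → InK-minus (z∈K (suc l)) (InK-* (z∈K zero) (offPivot-InK r y₀ l)))
  ... | y , c , reduced = y , (z zero ∷ c) , pivot-step r y₀ z (offPivot r y) c reduced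

  pivot-row-span : ∀ {n ρ} (r : Echelon (Fin q) n ρ) y (z : Vector Carrier (suc n)) → z zero ≢ 0# →
    Reduces r (λ l → z zero ⁻¹ * z (suc l)) y → InRowSpan (rows {suc n} {suc ρ} (inj₂ (r , y))) z
  pivot-row-span {n} {ρ} r y z z₀≢0 (c , reduced) = InRowSpan-resp {R = R} z≡z₀*T (InRowSpan-scale {R = R} (z zero) T-span)
    where
    R = rows {suc n} {suc ρ} (inj₂ (r , y))
    T : Vector Carrier (suc n)
    T = 1# ∷ (λ l → z zero ⁻¹ * z (suc l))
    T-span : InRowSpan R T
    T-span = (1# ∷ c) , λ
      { zero    → sym (trans (cong (1# * 1# +_) (∑-*-0 ρ c)) (trans (+-identityʳ _) (*-identityʳ 1#)))
      ; (suc l) → trans (reduced l) (cong (_+ ∑[ j < ρ ] (c j * rows r j l)) (sym (*-identityˡ _))) }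
    z≡z₀*T : ∀ l → z l ≡ z zero * T l
    z≡z₀*T zero    = sym (*-identityʳ (z zero))
    z≡z₀*T (suc l) = sym (trans (sym (*-assoc (z zero) _ _))
                         (trans (cong (_* z (suc l)) (inverse (z zero) z₀≢0)) (*-identityˡ _)))

  echelon-full : ∀ n → Σ (Echelon (Fin q) n n) λ r → ∀ z → InRowSpan (rows r) z
  echelon-full zero    = tt , λ z → (λ ()) , λ ()
  echelon-full (suc n) with echelon-full n
  ... | r , spans = inj₂ (r , y₀) , λ z → pivot-span r y₀ z (spans _)
    where
    y₀ : Vec (Fin q) (n ∸ n)
    y₀ = subst (Vec (Fin q)) (sym (n∸n≡0 n)) []

  Covers : ∀ {n ρ} → Echelon (Fin q) n ρ → (Fin ρ → Vector Carrier n) → Set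
  Covers r w = ∀ i → InRowSpan (rows r) (w i)

  cover-zero-column : ∀ {n ρ} (w : Fin (suc ρ) → Vector Carrier (suc n)) → (∀ i → w i zero ≡ 0#) →
    (r : Echelon (Fin q) n (suc ρ)) → Covers r (λ i l → w i (suc l)) → Covers {suc n} {suc ρ} (inj₁ r) w
  cover-zero-column {ρ = ρ} w first≡0 r covers i with covers i
  ... | c , tail≗ = c , λ { zero → trans (first≡0 i) (sym (∑-*-0 (suc ρ) c)) ; (suc l) → tail≗ l }

  cover-with-pivot : ∀ {n ρ} →
    (∀ (u : Fin ρ → Vector Carrier n) → (∀ j → AllInK (u j)) → Σ (Echelon (Fin q) n ρ) λ r → Covers r u) →
    (w : Fin (suc ρ) → Vector Carrier (suc n)) → (∀ i → AllInK (w i)) → (p : Fin (suc ρ)) → w p zero ≢ 0# →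
    Σ (Echelon (Fin q) (suc n) (suc ρ)) λ r → Covers r w
  cover-with-pivot {n} {ρ} cover-tails w w∈K p x≢0 = inj₂ (r , y) , covers
    where
    x = w p zero
    x⁻¹∈K = InK-⁻¹ (w∈K p zero) x≢0
    μ : Fin ρ → Carrier
    μ j = w (punchIn p j) zero * x ⁻¹
    u : Fin ρ → Vector Carrier n
    u j l = w (punchIn p j) (suc l) - μ j * w p (suc l)
    u∈K : ∀ j → AllInK (u j)
    u∈K j l = InK-minus (w∈K (punchIn p j) (suc l)) (InK-* (InK-* (w∈K (punchIn p j) zero) x⁻¹∈K) (w∈K p (suc l)))
    r = proj₁ (cover-tails u u∈K)
    y-reduces = reduce r (λ l → x ⁻¹ * w p (suc l)) (λ l → InK-* x⁻¹∈K (w∈K p (suc l)))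
    y = proj₁ y-reduces
    R = rows {suc n} {suc ρ} (inj₂ (r , y))
    wp-span : InRowSpan R (w p)
    wp-span = pivot-row-span r y (w p) x≢0 (proj₂ y-reduces)
    others-span : ∀ j → InRowSpan R (w (punchIn p j))
    others-span j = InRowSpan-resp {R = R} w≗ (InRowSpan-+* {R = R} (μ j) (pivot-span r y (0# ∷ u j) u-span) wp-span)
      where
      u-span : InRowSpan (rows r) (λ l → u j l - 0# * offPivot r y l)
      u-span = InRowSpan-resp (λ l → x-0*a≡x (u j l) (offPivot r y l)) (proj₂ (cover-tails u u∈K) j)
      w≗ : ∀ l → w (punchIn p j) l ≡ (0# ∷ u j) l + μ j * w p l
      w≗ zero    = sym (trans (+-identityˡ _) (trans (*-assoc _ (x ⁻¹) x)
                     (trans (cong (w (punchIn p j) zero *_) (trans (*-comm (x ⁻¹) x) (inverse x x≢0))) (*-identityʳ _))))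
      w≗ (suc l) = sym (//-rightDividesˡ (μ j * w p (suc l)) (w (punchIn p j) (suc l)))
    covers : Covers {suc n} {suc ρ} (inj₂ (r , y)) w
    covers i with i ≟ᶠ p
    ... | yes refl = wp-span
    ... | no i≢p   =
      subst (λ i → InRowSpan R (w i)) (punchIn-punchOut (i≢p ∘ sym)) (others-span (punchOut (i≢p ∘ sym)))

  echelon-covers : ∀ {n ρ} → ρ ≤ n → (w : Fin ρ → Vector Carrier n) → (∀ i → AllInK (w i)) →
                   Σ (Echelon (Fin q) n ρ) λ r → Covers r w
  echelon-covers {zero}  {zero}  _         w w∈K = tt , λ ()
  echelon-covers {suc n} {zero}  _         w w∈K = tt , λ ()
  echelon-covers {suc n} {suc ρ} (s≤s ρ≤n) w w∈K with any? (λ i → ¬? (w i zero ≟ 0#))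
  ... | yes (p , x≢0) = cover-with-pivot (echelon-covers ρ≤n) w w∈K p x≢0
  ... | no no-pivot with m≤n⇒m<n∨m≡n ρ≤n
  ...   | inj₂ refl = proj₁ (echelon-full (suc n)) , λ i → proj₂ (echelon-full (suc n)) (w i)
  ...   | inj₁ ρ<n  = inj₁ r , cover-zero-column w first≡0 r covers
    where
    first≡0 : ∀ i → w i zero ≡ 0#
    first≡0 i = decidable-stable (w i zero ≟ 0#) (λ x≢0 → no-pivot (i , x≢0))
    r = proj₁ (echelon-covers ρ<n (λ i l → w i (suc l)) (λ i l → w∈K i (suc l)))
    covers = proj₂ (echelon-covers ρ<n (λ i l → w i (suc l)) (λ i l → w∈K i (suc l)))

module SaturatingSystem (F : Field) {q : ℕ} (K : Subfield F q) (_≟_ : DecidableEquality (Field.Carrier F))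
                        {n k ρ : ℕ} (S : System F K n k) (saturating : RankSaturating F K S ρ) where
  import Data.Nat as ℕ
  open import Data.Nat.Properties using (≮⇒≥)
  open import Data.Fin.Properties using () renaming (_≟_ to _≟ᶠ_)
  open import Data.Vec using (lookup; tabulate)
  open import Data.Vec.Properties using (≡-dec; lookup-replicate; lookup∘tabulate)
  open import Relation.Nullary using (yes; no)
  open import Relation.Binary.PropositionalEquality
  open import Function.Bundles using (mk↣)
  open import Function.Definitions using (Injective)

  open Field F
  open Subfield K
  open System S
  open LinearAlgebra F
  open RowReduction F K _≟_

  coords : ∀ u → U u → Fin n → Fin q
  coords u u∈U = proj₁ (basis-span u u∈U)

  lincomb-of-U : ∀ {t} (c : Fin t → Carrier) (w : Fin t → V F k) (w∈U : ∀ j → U (w j)) →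
    lincomb F c w ≡ lincomb F (λ l → ∑[ j < t ] (c j * ι (coords (w j) (w∈U j) l))) basis
  lincomb-of-U c w w∈U =
    trans (lincomb-cong (λ _ → refl) (λ j → proj₂ (basis-span (w j) (w∈U j)))) (lincomb-lincomb c _ basis)

  basis≢0 : ∀ i → basis i ≢ 0v F
  basis≢0 i basis-i≡0 = 0≢1 (trans (sym (basis-indep δ δ-combination≡0 i)) ιδi≡1)
    where
    δ : Fin n → Fin q
    δ l with l ≟ᶠ i
    ... | yes _ = proj₁ has-1
    ... | no  _ = proj₁ has-0
    ιδi≡1 : ι (δ i) ≡ 1#
    ιδi≡1 with i ≟ᶠ i
    ... | yes _  = proj₂ has-1
    ... | no i≢i = ⊥-elim (i≢i refl)
    term≡0 : ∀ x l → ι (δ l) * lookup (basis l) x ≡ 0#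
    term≡0 x l with l ≟ᶠ i
    ... | yes refl =
      trans (cong (ι (proj₁ has-1) *_) (trans (cong (λ v → lookup v x) basis-i≡0) (lookup-replicate x 0#))) (zeroʳ _)
    ... | no _     = trans (cong (_* lookup (basis l) x) (proj₂ has-0)) (zeroˡ _)
    δ-combination≡0 : lincomb F (λ l → ι (δ l)) basis ≡ 0v F
    δ-combination≡0 = Vec-ext λ x → trans (lookup-lincomb _ basis x)
      (trans (trans (sum-cong-≗ {n} (term≡0 x)) (sum-replicate-zero n)) (sym (lookup-replicate x 0#)))

  covered-by-basis : CoveredBy F K S n
  covered-by-basis v _ with spans-Fk v
  ... | t , w , w∈U , c , v≡ = basis , (λ i → basis-U i , basis≢0 i) , _ , trans v≡ (lincomb-of-U c w w∈U)

  ρ≤n : ρ ≤ n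
  ρ≤n = ≮⇒≥ (λ n<ρ → proj₂ saturating n n<ρ covered-by-basis)

  every-vector-covered : ∀ v → Σ (Fin ρ → V F k) λ u → (∀ i → U (u i)) × InSpan F v u
  every-vector-covered v with ≡-dec _≟_ v (0v F)
  ... | yes refl = (λ _ → 0v F) , (λ _ → U-0) , (λ _ → 0#) , sym (lincomb-zero {t = ρ} (λ _ → 0v F))
  ... | no v≢0 with proj₁ saturating v v≢0
  ...   | u , u∈U , v∈span = u , (λ i → proj₁ (u∈U i)) , v∈span

  decode : Echelon (Fin q) n ρ × Vec Carrier ρ → V F k
  decode (r , a) = lincomb F (lookup a) (λ j → lincomb F (rows r j) basis)

  decode-section : ∀ v → Σ (Echelon (Fin q) n ρ × Vec Carrier ρ) λ e → decode e ≡ v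
  decode-section v with every-vector-covered v
  ... | u , u∈U , c , v≡ with echelon-covers ρ≤n (λ i l → ι (coords (u i) (u∈U i) l)) (λ i l → _ , refl)
  ...   | r , covers = (r , tabulate c′) , sym (begin
      v
    ≡⟨ v≡ ⟩
      lincomb F c u
    ≡⟨ lincomb-cong (λ _ → refl) (λ i → proj₂ (basis-span (u i) (u∈U i))) ⟩
      lincomb F c (λ i → lincomb F (λ l → ι (coords (u i) (u∈U i) l)) basis)
    ≡⟨ lincomb-cong (λ _ → refl) (λ i → trans (lincomb-cong (proj₂ (covers i)) (λ _ → refl))
                                              (sym (lincomb-lincomb (β i) (rows r) basis))) ⟩
      lincomb F c (λ i → lincomb F (β i) W)
    ≡⟨ lincomb-lincomb c β W ⟩
      lincomb F c′ W
    ≡⟨ lincomb-cong (λ j → sym (lookup∘tabulate c′ j)) (λ _ → refl) ⟩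
      decode (r , tabulate c′)
    ∎)
    where
    open ≡-Reasoning
    W : Fin ρ → V F k
    W j = lincomb F (rows r j) basis
    β : Fin ρ → Fin ρ → Carrier
    β i = proj₁ (covers i)
    c′ : Fin ρ → Carrier
    c′ j = ∑[ i < ρ ] (c i * β i j)

  encode : V F k → Echelon (Fin q) n ρ × Vec Carrier ρ
  encode v = proj₁ (decode-section v)

  encode-injective : Injective _≡_ _≡_ encode
  encode-injective {v} {w} e = trans (sym (proj₂ (decode-section v))) (trans (cong decode e) (proj₂ (decode-section w)))

  encode-count : ∀ {m} → Carrier ↔ Fin (q ^ m) → (q ^ m) ^ k ≤ QBinomial.qbinom q n ρ ℕ.* (q ^ m) ^ ρ
  encode-count F↔ = ↣⇒≤ (Vec↔Fin^ k F↔)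
    (↔-trans (QBinomial.Echelon↔Fin q ↔-refl n ρ ×-↔ Vec↔Fin^ ρ F↔) (↔-sym *↔×)) (mk↣ encode-injective)

open import Data.Nat using (_+_; _*_; _≥_)
open import Data.Nat.Properties using (^-monoʳ-≤; <-≤-trans; *-identityʳ)
open import Data.Nat.Primality using (prime⇒nonTrivial; prime⇒nonZero)
open import Data.Nat.Base using (nonTrivial⇒n>1)
open import Data.Fin.Properties using (inj⇒≟)
open import Relation.Binary.PropositionalEquality using (subst)

IsPrimePower⇒>1 : ∀ {q} → IsPrimePower q → 1 < q
IsPrimePower⇒>1 (p , e , p-prime , 1≤e , refl) =
  <-≤-trans (nonTrivial⇒n>1 p {{prime⇒nonTrivial p-prime}})
            (subst (_≤ p ^ e) (*-identityʳ p) (^-monoʳ-≤ p {{prime⇒nonZero p-prime}} 1≤e))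

theorem3p3 : (q m n k ρ : ℕ) → IsPrimePower q → 1 ≤ m → 1 ≤ n → 1 ≤ k →
    1 ≤ ρ → ρ ≤ k → ρ ≤ m →
    (F : Field) → Field.Carrier F ↔ Fin (q ^ m) →
    (K : Subfield F q) → (S : System F K n k) → RankSaturating F K S ρ →
    (gauss q n ρ ≥ q ^ (m * (k ∸ ρ)))
    × (2 < q → n + m ≥ ceilDiv (m * k) ρ + ρ)
    × (q ≡ 2 → 1 < ρ → n + m ≥ ceilDiv (m * k ∸ 1) ρ + ρ)
    × (q ≡ 2 → ρ ≡ 1 → n ≥ m * (k ∸ 1) + 1)
theorem3p3 q m n k ρ q-prime-power _ _ _ 1≤ρ ρ≤k _ F F↔ K S saturating =
  QBinomial.dimension-bounds q (IsPrimePower⇒>1 q-prime-power) m n k ρ 1≤ρ ρ≤k ρ≤n (encode-count {m} F↔)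
  where open SaturatingSystem F K (inj⇒≟ (↔⇒↣ F↔)) S saturating
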